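{- Fix an extended type $\tau=(\tau_1,\tau_2)$. Let $\mathbf{Lat}^*$ be the category of complete lattices whose morphisms are maps preserving $0,1$, arbitrary joins and arbitrary meets; let $\mathbf{Rel}_\tau$ be the category of extended relational structures of type $\tau$ with $p$-morphisms; and let $\mathbf{Alg}_\tau$ be the category of bounded lattices with families of additional operations of types $\tau_1$ and $\tau_2$ and their homomorphisms. Then $(L,\mathfrak{X})\mapsto L^{\mathfrak{X}*}$, sending $\phi:L\to M$ to $\alpha\mapsto\phi\circ\alpha$ and a $p$-morphism $p:\mathfrak{X}\to\mathfrak{Y}$ to $\beta\mapsto\beta\circ p$ (from $L^{\mathfrak{Y}*}$ to $L^{\mathfrak{X}*}$), is a bifunctor $\mathbf{Lat}^*\times\mathbf{Rel}_\tau\to\mathbf{Alg}_\tau$, covariant in the first argument and contravariant in the second. It preserves products in the first argument ($(\prod_J L_j)^{\mathfrak{X}*}\cong\prod_J L_j^{\mathfrak{X}*}$), takes coproducts (disjoint unions) to products in the second argument, $\alpha\mapsto\phi\circ\alpha$ is one-one (onto) whenever $\phi$ is, with the converse holding when $X$ is nonempty, and if a $p$-morphism $p$ is one-one (onto) then $\beta\mapsto\beta\circ p$ is onto (one-one).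
   Context: An extended type is a pair $\tau=(\tau_1,\tau_2)$ of types $\tau_1:I\to\mathbb{N}$, $\tau_2:J\to\mathbb{N}$, with arities $n_i$, $n_j$. An extended relational structure of type $\tau$ is $\mathfrak{X}=(X,(R_i)_{i\in I},(S_j)_{j\in J})$ with $R_i\subseteq X^{n_i+1}$, $S_j\subseteq X^{n_j+1}$. For a complete lattice $L$, $L^{\mathfrak{X}*}$ is $L^X$ with pointwise $\wedge,\vee,0,1$ and operations $f_i(\alpha_1,\ldots,\alpha_{n_i})(x)=\bigvee\{\alpha_1(x_1)\wedge\cdots\wedge\alpha_{n_i}(x_{n_i}):(x_1,\ldots,x_{n_i},x)\in R_i\}$ and $g_j(\alpha_1,\ldots,\alpha_{n_j})(x)=\bigwedge\{\alpha_1(x_1)\vee\cdots\vee\alpha_{n_j}(x_{n_j}):(x_1,\ldots,x_{n_j},x)\in S_j\}$. A $p$-morphism $p:X\to Y$ between extended relational structures $(X,(R_i),(S_j))$, $(Y,(R_i'),(S_j'))$ satisfies, for every relation index $k$ (of either family) with corresponding relations $T_k$ on $X$, $T_k'$ on $Y$ of arity $n_k+1$ and every $x\in X$: $\{(y_1,\ldots,y_{n_k}):(y_1,\ldots,y_{n_k},p(x))\in T_k'\}=\{(p(x_1),\ldots,p(x_{n_k})):(x_1,\ldots,x_{n_k},x)\in T_k\}$. The coproduct is disjoint union with relations taken as unions. -}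

module Defs where

open import Level using (Level; Lift; lift; _⊔_) renaming (suc to lsuc)
open import Data.Nat using (ℕ; zero; suc)
open import Data.Fin using (Fin; zero; suc)
open import Data.Bool using (Bool; true; false; if_then_else_)
open import Data.Empty using (⊥)
open import Data.Product using (Σ; _×_; _,_; proj₁; proj₂; ∃)
open import Function using (_∘_; id)
open import Function.Bundles using (_⇔_)
open import Relation.Binary.Core using (Rel)
open import Relation.Binary.Structures using (IsPartialOrder; IsPreorder; IsEquivalence)
open import Relation.Binary.PropositionalEquality using (_≡_)
open import Algebra.Lattice.Structures using (IsLattice)

record CompleteLattice (ℓ : Level) : Set (lsuc ℓ) where
  infix 4 _≈_ _≤_
  field
    Carrier        : Set ℓ
    _≈_            : Rel Carrier ℓ
    _≤_            : Rel Carrier ℓ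
    isPartialOrder : IsPartialOrder _≈_ _≤_
    ⋁              : {A : Set ℓ} → (A → Carrier) → Carrier
    ⋀              : {A : Set ℓ} → (A → Carrier) → Carrier
    ⋁-upper        : {A : Set ℓ} (F : A → Carrier) (a : A) → F a ≤ ⋁ F
    ⋁-least        : {A : Set ℓ} (F : A → Carrier) (c : Carrier) →
                     ((a : A) → F a ≤ c) → ⋁ F ≤ c
    ⋀-lower        : {A : Set ℓ} (F : A → Carrier) (a : A) → ⋀ F ≤ F a
    ⋀-greatest     : {A : Set ℓ} (F : A → Carrier) (c : Carrier) →
                     ((a : A) → c ≤ F a) → c ≤ ⋀ F

  open IsPartialOrder isPartialOrder public

  pair : Carrier → Carrier → Lift ℓ Bool → Carrier
  pair a b (lift x) = if x then a else b

  _∨_ : Carrier → Carrier → Carrier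
  a ∨ b = ⋁ (pair a b)

  _∧_ : Carrier → Carrier → Carrier
  a ∧ b = ⋀ (pair a b)

  𝟘 : Carrier
  𝟘 = ⋁ {Lift ℓ ⊥} (λ ())

  𝟙 : Carrier
  𝟙 = ⋀ {Lift ℓ ⊥} (λ ())

  ⋀ⁿ : {n : ℕ} → (Fin n → Carrier) → Carrier
  ⋀ⁿ {zero}  a = 𝟙
  ⋀ⁿ {suc n} a = a zero ∧ ⋀ⁿ (a ∘ suc)

  ⋁ⁿ : {n : ℕ} → (Fin n → Carrier) → Carrier
  ⋁ⁿ {zero}  a = 𝟘
  ⋁ⁿ {suc n} a = a zero ∨ ⋁ⁿ (a ∘ suc)

record IsLatStarHom {ℓ : Level} (L M : CompleteLattice ℓ)
         (φ : CompleteLattice.Carrier L → CompleteLattice.Carrier M) : Set (lsuc ℓ) where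
  private
    module L = CompleteLattice L
    module M = CompleteLattice M
  field
    cong   : ∀ {a b} → a L.≈ b → φ a M.≈ φ b
    pres-𝟘 : φ L.𝟘 M.≈ M.𝟘
    pres-𝟙 : φ L.𝟙 M.≈ M.𝟙
    pres-⋁ : {A : Set ℓ} (F : A → L.Carrier) → φ (L.⋁ F) M.≈ M.⋁ (φ ∘ F)
    pres-⋀ : {A : Set ℓ} (F : A → L.Carrier) → φ (L.⋀ F) M.≈ M.⋀ (φ ∘ F)

∏CL : {ℓ : Level} (K : Set ℓ) → (K → CompleteLattice ℓ) → CompleteLattice ℓ
∏CL {ℓ} K Ls = record
  { Carrier = (k : K) → C k
  ; _≈_ = λ a b → ∀ k → E k (a k) (b k)
  ; _≤_ = λ a b → ∀ k → Le k (a k) (b k)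
  ; isPartialOrder = record
    { isPreorder = record
      { isEquivalence = record
        { refl = λ k → IsPartialOrder.Eq.refl (po k)
        ; sym = λ p k → IsPartialOrder.Eq.sym (po k) (p k)
        ; trans = λ p q k → IsPartialOrder.Eq.trans (po k) (p k) (q k) }
      ; reflexive = λ p k → IsPartialOrder.reflexive (po k) (p k)
      ; trans = λ p q k → IsPartialOrder.trans (po k) (p k) (q k) }
    ; antisym = λ p q k → IsPartialOrder.antisym (po k) (p k) (q k) }
  ; ⋁ = λ F k → CompleteLattice.⋁ (Ls k) (λ a → F a k)
  ; ⋀ = λ F k → CompleteLattice.⋀ (Ls k) (λ a → F a k)
  ; ⋁-upper = λ F a k → CompleteLattice.⋁-upper (Ls k) (λ b → F b k) a
  ; ⋁-least = λ F c h k → CompleteLattice.⋁-least (Ls k) (λ b → F b k) (c k) (λ a → h a k)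
  ; ⋀-lower = λ F a k → CompleteLattice.⋀-lower (Ls k) (λ b → F b k) a
  ; ⋀-greatest = λ F c h k → CompleteLattice.⋀-greatest (Ls k) (λ b → F b k) (c k) (λ a → h a k)
  }
  where
  C = λ k → CompleteLattice.Carrier (Ls k)
  E = λ k → CompleteLattice._≈_ (Ls k)
  Le = λ k → CompleteLattice._≤_ (Ls k)
  po = λ k → CompleteLattice.isPartialOrder (Ls k)

record ExtType (ℓ : Level) : Set (lsuc ℓ) where
  field
    I  : Set ℓ
    J  : Set ℓ
    τ₁ : I → ℕ
    τ₂ : J → ℕ

module _ {ℓ : Level} (τ : ExtType ℓ) where
  open ExtType τ

  -- Extended relational structures of type τ.  An (n+1)-ary relation
  -- T ⊆ X^(n+1) is represented as  T (x₁,…,xₙ) x  for (x₁,…,xₙ,x) ∈ T.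
  record RelStr : Set (lsuc ℓ) where
    field
      X : Set ℓ
      R : (i : I) → (Fin (τ₁ i) → X) → X → Set ℓ
      S : (j : J) → (Fin (τ₂ j) → X) → X → Set ℓ

  record RawAlg : Set (lsuc ℓ) where
    infix 4 _≈_
    field
      Carrier : Set ℓ
      _≈_     : Rel Carrier ℓ
      _∧_     : Carrier → Carrier → Carrier
      _∨_     : Carrier → Carrier → Carrier
      ⊤       : Carrier
      ⊥'      : Carrier
      f       : (i : I) → (Fin (τ₁ i) → Carrier) → Carrier
      g       : (j : J) → (Fin (τ₂ j) → Carrier) → Carrier

  record IsAlg (A : RawAlg) : Set ℓ where
    open RawAlg A
    field
      isLattice : IsLattice _≈_ _∨_ _∧_
      ⊥'-least  : ∀ x → (x ∨ ⊥') ≈ x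
      ⊤-greatest : ∀ x → (x ∧ ⊤) ≈ x
      f-cong    : ∀ i (as bs : Fin (τ₁ i) → Carrier) → (∀ k → as k ≈ bs k) → f i as ≈ f i bs
      g-cong    : ∀ j (as bs : Fin (τ₂ j) → Carrier) → (∀ k → as k ≈ bs k) → g j as ≈ g j bs

  record IsHom (A B : RawAlg) (h : RawAlg.Carrier A → RawAlg.Carrier B) : Set ℓ where
    private
      module A = RawAlg A
      module B = RawAlg B
    field
      cong   : ∀ {a b} → a A.≈ b → h a B.≈ h b
      pres-∧ : ∀ a b → h (a A.∧ b) B.≈ (h a B.∧ h b)
      pres-∨ : ∀ a b → h (a A.∨ b) B.≈ (h a B.∨ h b)
      pres-⊤ : h A.⊤ B.≈ B.⊤
      pres-⊥ : h A.⊥' B.≈ B.⊥'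
      pres-f : ∀ i (as : Fin (τ₁ i) → A.Carrier) → h (A.f i as) B.≈ B.f i (h ∘ as)
      pres-g : ∀ j (as : Fin (τ₂ j) → A.Carrier) → h (A.g j as) B.≈ B.g j (h ∘ as)

  ∏Alg : (K : Set ℓ) → (K → RawAlg) → RawAlg
  ∏Alg K As = record
    { Carrier = (k : K) → RawAlg.Carrier (As k)
    ; _≈_ = λ a b → ∀ k → RawAlg._≈_ (As k) (a k) (b k)
    ; _∧_ = λ a b k → RawAlg._∧_ (As k) (a k) (b k)
    ; _∨_ = λ a b k → RawAlg._∨_ (As k) (a k) (b k)
    ; ⊤ = λ k → RawAlg.⊤ (As k)
    ; ⊥' = λ k → RawAlg.⊥' (As k)
    ; f = λ i as k → RawAlg.f (As k) i (λ m → as m k)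
    ; g = λ j as k → RawAlg.g (As k) j (λ m → as m k)
    }

  PCond : {X Y : Set ℓ} (p : X → Y) {n : ℕ} →
          ((Fin n → X) → X → Set ℓ) → ((Fin n → Y) → Y → Set ℓ) → Set ℓ
  PCond {X} p {n} T T' =
    ∀ (x : X) ys → T' ys (p x) ⇔ (Σ (Fin n → X) λ xs → T xs x × (∀ k → p (xs k) ≡ ys k))

  IsPMorphism : (𝔛 𝔜 : RelStr) → (RelStr.X 𝔛 → RelStr.X 𝔜) → Set ℓ
  IsPMorphism 𝔛 𝔜 p =
    (∀ i → PCond p (RelStr.R 𝔛 i) (RelStr.R 𝔜 i)) ×
    (∀ j → PCond p (RelStr.S 𝔛 j) (RelStr.S 𝔜 j))

  ∐Rel : (K : Set ℓ) → (K → RelStr) → RelStr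
  ∐Rel K 𝔛s = record
    { X = Σ K (λ k → RelStr.X (𝔛s k))
    ; R = λ i zs z → Σ (Fin (τ₁ i) → RelStr.X (𝔛s (proj₁ z))) λ xs →
            (∀ m → zs m ≡ (proj₁ z , xs m)) × RelStr.R (𝔛s (proj₁ z)) i xs (proj₂ z)
    ; S = λ j zs z → Σ (Fin (τ₂ j) → RelStr.X (𝔛s (proj₁ z))) λ xs →
            (∀ m → zs m ≡ (proj₁ z , xs m)) × RelStr.S (𝔛s (proj₁ z)) j xs (proj₂ z)
    }

  Pow : CompleteLattice ℓ → RelStr → RawAlg
  Pow L 𝔛 = record
    { Carrier = X → Carrier
    ; _≈_ = λ α β → ∀ x → α x ≈ β x
    ; _∧_ = λ α β x → α x ∧ β x
    ; _∨_ = λ α β x → α x ∨ β x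
    ; ⊤ = λ _ → 𝟙
    ; ⊥' = λ _ → 𝟘
    ; f = λ i αs x → ⋁ {Σ (Fin (τ₁ i) → X) (λ xs → R i xs x)}
                       (λ t → ⋀ⁿ (λ m → αs m (proj₁ t m)))
    ; g = λ j αs x → ⋀ {Σ (Fin (τ₂ j) → X) (λ xs → S j xs x)}
                       (λ t → ⋁ⁿ (λ m → αs m (proj₁ t m)))
    }
    where
    open CompleteLattice L
    open RelStr 𝔛

  mapL : (L M : CompleteLattice ℓ) (𝔛 : RelStr) →
         (CompleteLattice.Carrier L → CompleteLattice.Carrier M) →
         RawAlg.Carrier (Pow L 𝔛) → RawAlg.Carrier (Pow M 𝔛)
  mapL L M 𝔛 φ α = φ ∘ α

  mapX : (L : CompleteLattice ℓ) (𝔛 𝔜 : RelStr) → (RelStr.X 𝔛 → RelStr.X 𝔜) →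
         RawAlg.Carrier (Pow L 𝔜) → RawAlg.Carrier (Pow L 𝔛)
  mapX L 𝔛 𝔜 p β = β ∘ p

  prodCmp : (K : Set ℓ) (Ls : K → CompleteLattice ℓ) (𝔛 : RelStr) →
            RawAlg.Carrier (Pow (∏CL K Ls) 𝔛) → RawAlg.Carrier (∏Alg K (λ k → Pow (Ls k) 𝔛))
  prodCmp K Ls 𝔛 α k x = α x k

  coprodCmp : (L : CompleteLattice ℓ) (K : Set ℓ) (𝔛s : K → RelStr) →
              RawAlg.Carrier (Pow L (∐Rel K 𝔛s)) → RawAlg.Carrier (∏Alg K (λ k → Pow L (𝔛s k)))
  coprodCmp L K 𝔛s β k x = β (k , x)

module Submission where

-- Everything in L^{𝔛*} is computed pointwise in L, so the proof splits into
-- facts about complete lattices and facts about the two actions: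
--   * In a complete lattice, comparing joins/meets of families that match up
--     member by member gives all congruences and the "cover" lemma below;
--     binary ∧, ∨ form a lattice, bounded by 𝟘 and 𝟙.
--   * A Lat*-morphism preserves the binary and finite meets/joins, hence the
--     operations fᵢ, gⱼ of L^{𝔛*}, so α ↦ φ ∘ α is a homomorphism.
--   * The p-morphism condition says exactly that the tuples related to p x
--     are the p-images of the tuples related to x; hence the join (meet)
--     defining fᵢ β (p x) equals the one defining fᵢ (β ∘ p) x, so β ↦ β ∘ p
--     is a homomorphism.
--   * The product and coproduct comparison maps are the tuplings of the
--     homomorphisms induced by the projections of ∏ Lₖ (Lat*-morphisms) and
--     the injections into ∐ 𝔛ₖ (p-morphisms); as maps they are (un)currying.
--   * The one-one/onto statements are facts about pre- and postcomposition
--     of functions; extending along an injective p uses joins over fibres.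
-- The functor laws hold definitionally.

open import Level using (Level; _⊔_; lift)
open import Data.Bool using (true; false)
open import Data.Nat using (ℕ; zero; suc)
open import Data.Fin using (Fin)
open import Data.Product using (_×_; Σ; _,_; proj₁; proj₂)
open import Function using (_∘_; id)
open import Function.Bundles using (mk⇔; Equivalence)
open import Function.Definitions using (Injective; Surjective)
open import Relation.Binary.Core using (Rel)
open import Relation.Binary.PropositionalEquality
  using (_≡_; refl; sym; subst) renaming (cong to ≡-cong)
import Data.Fin as Fin
import Relation.Binary.Lattice as Order
import Relation.Binary.Lattice.Properties.Lattice as OrderLatticeProperties
open import Defs

Pointwise : {a r : Level} {A : Set a} (X : Set a) → Rel A r → Rel (X → A) (a ⊔ r)
Pointwise X _≈_ f g = ∀ x → f x ≈ g x

pointwiseLattice : {a : Level} (X : Set a) → Order.Lattice a a a → Order.Lattice a a a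
pointwiseLattice X L = record
  { Carrier = X → Carrier
  ; _≈_ = Pointwise X _≈_
  ; _≤_ = Pointwise X _≤_
  ; _∨_ = λ α β x → α x ∨ β x
  ; _∧_ = λ α β x → α x ∧ β x
  ; isLattice = record
    { isPartialOrder = record
      { isPreorder = record
        { isEquivalence = record
          { refl = λ x → Eq.refl
          ; sym = λ p x → Eq.sym (p x)
          ; trans = λ p q x → Eq.trans (p x) (q x) }
        ; reflexive = λ p x → reflexive (p x)
        ; trans = λ p q x → trans (p x) (q x) }
      ; antisym = λ p q x → antisym (p x) (q x) }
    ; supremum = λ α β →
        (λ x → proj₁ (supremum (α x) (β x))) ,
        (λ x → proj₁ (proj₂ (supremum (α x) (β x)))) ,
        (λ γ p q x → proj₂ (proj₂ (supremum (α x) (β x))) (γ x) (p x) (q x))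
    ; infimum = λ α β →
        (λ x → proj₁ (infimum (α x) (β x))) ,
        (λ x → proj₁ (proj₂ (infimum (α x) (β x)))) ,
        (λ γ p q x → proj₂ (proj₂ (infimum (α x) (β x))) (γ x) (p x) (q x))
    }
  }
  where open Order.Lattice L

module Postcomposition {a r : Level} {A B : Set a}
  (_≈₁_ : Rel A r) (_≈₂_ : Rel B r) (φ : A → B) (X : Set a) where

  injective : Injective _≈₁_ _≈₂_ φ → Injective (Pointwise X _≈₁_) (Pointwise X _≈₂_) (φ ∘_)
  injective inj e x = inj (e x)

  surjective : Surjective _≈₁_ _≈₂_ φ → Surjective (Pointwise X _≈₁_) (Pointwise X _≈₂_) (φ ∘_)
  surjective surj β = (λ x → proj₁ (surj (β x))) , λ e x → proj₂ (surj (β x)) (e x)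

  -- Conversely, on a nonempty X one tests φ ∘_ on constant functions.
  injective⁻¹ : X → Injective (Pointwise X _≈₁_) (Pointwise X _≈₂_) (φ ∘_) → Injective _≈₁_ _≈₂_ φ
  injective⁻¹ x₀ inj {u} {v} e = inj {λ _ → u} {λ _ → v} (λ _ → e) x₀

  -- Here φ must respect the equalities, since only the preimage's value
  -- at x₀ is known.
  surjective⁻¹ : (∀ {u v} → u ≈₁ v → φ u ≈₂ φ v) →
    (∀ {u} → u ≈₁ u) → (∀ {u v w} → u ≈₂ v → v ≈₂ w → u ≈₂ w) →
    X → Surjective (Pointwise X _≈₁_) (Pointwise X _≈₂_) (φ ∘_) → Surjective _≈₁_ _≈₂_ φ
  surjective⁻¹ φ-cong ≈₁-refl ≈₂-trans x₀ surj b with surj (λ _ → b)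
  ... | α , φα≈b = α x₀ , λ e → ≈₂-trans (φ-cong e) (φα≈b (λ _ → ≈₁-refl) x₀)

precompose-injective :
  {a r : Level} {A : Set a} {_≈_ : Rel A r} {X Y : Set a} (p : X → Y) →
  Surjective _≡_ _≡_ p → Injective (Pointwise Y _≈_) (Pointwise X _≈_) (_∘ p)
precompose-injective {_≈_ = _≈_} p surj {β} {β′} e y =
  subst (λ w → β w ≈ β′ w) (proj₂ (surj y) refl) (e (proj₁ (surj y)))

module CompleteLatticeProperties {ℓ : Level} (L : CompleteLattice ℓ) where
  open CompleteLattice L renaming (refl to ≤-refl; trans to ≤-trans; reflexive to ≤-reflexive)

  ⋁-mono : {A B : Set ℓ} (F : A → Carrier) (G : B → Carrier) →
           (∀ a → Σ B λ b → F a ≤ G b) → ⋁ F ≤ ⋁ G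
  ⋁-mono F G h = ⋁-least F (⋁ G) (λ a → ≤-trans (proj₂ (h a)) (⋁-upper G (proj₁ (h a))))

  ⋀-mono : {A B : Set ℓ} (F : A → Carrier) (G : B → Carrier) →
           (∀ b → Σ A λ a → F a ≤ G b) → ⋀ F ≤ ⋀ G
  ⋀-mono F G h = ⋀-greatest G (⋀ F) (λ b → ≤-trans (⋀-lower F (proj₁ (h b))) (proj₂ (h b)))

  ⋁-cover : {A B : Set ℓ} (s : A → B) (G : B → Carrier) →
            (∀ b → Σ A λ a → G (s a) ≈ G b) → ⋁ (G ∘ s) ≈ ⋁ G
  ⋁-cover s G hit = antisym
    (⋁-mono (G ∘ s) G (λ a → s a , ≤-refl))
    (⋁-mono G (G ∘ s) (λ b → proj₁ (hit b) , ≤-reflexive (Eq.sym (proj₂ (hit b)))))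

  ⋀-cover : {A B : Set ℓ} (s : A → B) (G : B → Carrier) →
            (∀ b → Σ A λ a → G (s a) ≈ G b) → ⋀ (G ∘ s) ≈ ⋀ G
  ⋀-cover s G hit = antisym
    (⋀-mono (G ∘ s) G (λ b → proj₁ (hit b) , ≤-reflexive (proj₂ (hit b))))
    (⋀-mono G (G ∘ s) (λ a → s a , ≤-refl))

  ⋁-cong : {A : Set ℓ} (F G : A → Carrier) → (∀ a → F a ≈ G a) → ⋁ F ≈ ⋁ G
  ⋁-cong F G e = antisym (⋁-mono F G (λ a → a , ≤-reflexive (e a)))
                         (⋁-mono G F (λ a → a , ≤-reflexive (Eq.sym (e a))))

  ⋀-cong : {A : Set ℓ} (F G : A → Carrier) → (∀ a → F a ≈ G a) → ⋀ F ≈ ⋀ G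
  ⋀-cong F G e = antisym (⋀-mono F G (λ a → a , ≤-reflexive (e a)))
                         (⋀-mono G F (λ a → a , ≤-reflexive (Eq.sym (e a))))

  pair-cong : ∀ {a b c d} → a ≈ c → b ≈ d → ∀ t → pair a b t ≈ pair c d t
  pair-cong p q (lift true) = p
  pair-cong p q (lift false) = q

  ∧-cong : ∀ {a b c d} → a ≈ c → b ≈ d → a ∧ b ≈ c ∧ d
  ∧-cong p q = ⋀-cong _ _ (pair-cong p q)

  ∨-cong : ∀ {a b c d} → a ≈ c → b ≈ d → a ∨ b ≈ c ∨ d
  ∨-cong p q = ⋁-cong _ _ (pair-cong p q)

  ⋀ⁿ-cong : ∀ {n} (as bs : Fin n → Carrier) → (∀ m → as m ≈ bs m) → ⋀ⁿ as ≈ ⋀ⁿ bs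
  ⋀ⁿ-cong {zero} as bs e = Eq.refl
  ⋀ⁿ-cong {suc n} as bs e =
    ∧-cong (e Fin.zero) (⋀ⁿ-cong (as ∘ Fin.suc) (bs ∘ Fin.suc) (e ∘ Fin.suc))

  ⋁ⁿ-cong : ∀ {n} (as bs : Fin n → Carrier) → (∀ m → as m ≈ bs m) → ⋁ⁿ as ≈ ⋁ⁿ bs
  ⋁ⁿ-cong {zero} as bs e = Eq.refl
  ⋁ⁿ-cong {suc n} as bs e =
    ∨-cong (e Fin.zero) (⋁ⁿ-cong (as ∘ Fin.suc) (bs ∘ Fin.suc) (e ∘ Fin.suc))

  binaryLattice : Order.Lattice ℓ ℓ ℓ
  binaryLattice = record
    { Carrier = Carrier
    ; _≈_ = _≈_
    ; _≤_ = _≤_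
    ; _∨_ = _∨_
    ; _∧_ = _∧_
    ; isLattice = record
      { isPartialOrder = isPartialOrder
      ; supremum = λ a b →
          ⋁-upper (pair a b) (lift true) , ⋁-upper (pair a b) (lift false) ,
          λ c p q → ⋁-least (pair a b) c (λ { (lift true) → p ; (lift false) → q })
      ; infimum = λ a b →
          ⋀-lower (pair a b) (lift true) , ⋀-lower (pair a b) (lift false) ,
          λ c p q → ⋀-greatest (pair a b) c (λ { (lift true) → p ; (lift false) → q })
      }
    }

  ∨-identityʳ : ∀ a → a ∨ 𝟘 ≈ a
  ∨-identityʳ a = antisym
    (⋁-least (pair a 𝟘) a (λ { (lift true) → ≤-refl ; (lift false) → ⋁-least _ a (λ ()) }))
    (⋁-upper (pair a 𝟘) (lift true))

  ∧-identityʳ : ∀ a → a ∧ 𝟙 ≈ a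
  ∧-identityʳ a = antisym
    (⋀-lower (pair a 𝟙) (lift true))
    (⋀-greatest (pair a 𝟙) a (λ { (lift true) → ≤-refl ; (lift false) → ⋀-greatest _ a (λ ()) }))

  -- Along an injective p every γ : X → L extends to Y: take the join of γ
  -- over each fibre.  So precomposition with p is onto.
  precompose-surjective : {X Y : Set ℓ} (p : X → Y) → Injective _≡_ _≡_ p →
    Surjective (Pointwise Y _≈_) (Pointwise X _≈_) (_∘ p)
  precompose-surjective {X} {Y} p inj γ = extension , λ e x → Eq.trans (e (p x)) (extends x)
    where
    extension : Y → Carrier
    extension y = ⋁ {Σ X (λ x → p x ≡ y)} (γ ∘ proj₁)

    extends : ∀ x → extension (p x) ≈ γ x
    extends x = antisym
      (⋁-least _ _ (λ { (x′ , px′≡px) → ≤-reflexive (Eq.reflexive (≡-cong γ (inj px′≡px))) }))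
      (⋁-upper _ (x , refl))

module LatStarHomProperties {ℓ : Level} {L M : CompleteLattice ℓ}
  {φ : CompleteLattice.Carrier L → CompleteLattice.Carrier M} (h : IsLatStarHom L M φ) where
  private
    module L = CompleteLattice L
    module M = CompleteLattice M
  open CompleteLatticeProperties M
  open IsLatStarHom h

  pres-pair : ∀ a b t → φ (L.pair a b t) M.≈ M.pair (φ a) (φ b) t
  pres-pair a b (lift true) = M.Eq.refl
  pres-pair a b (lift false) = M.Eq.refl

  pres-∧ : ∀ a b → φ (a L.∧ b) M.≈ (φ a M.∧ φ b)
  pres-∧ a b = M.Eq.trans (pres-⋀ (L.pair a b)) (⋀-cong _ _ (pres-pair a b))

  pres-∨ : ∀ a b → φ (a L.∨ b) M.≈ (φ a M.∨ φ b)
  pres-∨ a b = M.Eq.trans (pres-⋁ (L.pair a b)) (⋁-cong _ _ (pres-pair a b))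

  pres-⋀ⁿ : ∀ {n} (as : Fin n → L.Carrier) → φ (L.⋀ⁿ as) M.≈ M.⋀ⁿ (φ ∘ as)
  pres-⋀ⁿ {zero} as = pres-𝟙
  pres-⋀ⁿ {suc n} as = M.Eq.trans (pres-∧ _ _) (∧-cong M.Eq.refl (pres-⋀ⁿ (as ∘ Fin.suc)))

  pres-⋁ⁿ : ∀ {n} (as : Fin n → L.Carrier) → φ (L.⋁ⁿ as) M.≈ M.⋁ⁿ (φ ∘ as)
  pres-⋁ⁿ {zero} as = pres-𝟘
  pres-⋁ⁿ {suc n} as = M.Eq.trans (pres-∨ _ _) (∨-cong M.Eq.refl (pres-⋁ⁿ (as ∘ Fin.suc)))

projection-isLatStarHom : {ℓ : Level} (K : Set ℓ) (Ls : K → CompleteLattice ℓ) (k : K) →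
  IsLatStarHom (∏CL K Ls) (Ls k) (λ a → a k)
projection-isLatStarHom K Ls k = record
  { cong = λ e → e k
  ; pres-𝟘 = ⋁-cong _ _ (λ ())
  ; pres-𝟙 = ⋀-cong _ _ (λ ())
  ; pres-⋁ = λ F → Eq.refl
  ; pres-⋀ = λ F → Eq.refl
  }
  where
  open CompleteLattice (Ls k)
  open CompleteLatticeProperties (Ls k)

module _ {ℓ : Level} (τ : ExtType ℓ) where

  Pow-isAlg : (L : CompleteLattice ℓ) (𝔛 : RelStr τ) → IsAlg τ (Pow τ L 𝔛)
  Pow-isAlg L 𝔛 = record
    { isLattice = OrderLatticeProperties.isAlgLattice
                    (pointwiseLattice (RelStr.X 𝔛) binaryLattice)
    ; ⊥'-least = λ α x → ∨-identityʳ (α x)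
    ; ⊤-greatest = λ α x → ∧-identityʳ (α x)
    ; f-cong = λ i as bs e x → ⋁-cong _ _ (λ t → ⋀ⁿ-cong _ _ (λ m → e m (proj₁ t m)))
    ; g-cong = λ j as bs e x → ⋀-cong _ _ (λ t → ⋁ⁿ-cong _ _ (λ m → e m (proj₁ t m)))
    }
    where open CompleteLatticeProperties L

  mapL-isHom : (L M : CompleteLattice ℓ) (𝔛 : RelStr τ)
    (φ : CompleteLattice.Carrier L → CompleteLattice.Carrier M) →
    IsLatStarHom L M φ → IsHom τ (Pow τ L 𝔛) (Pow τ M 𝔛) (mapL τ L M 𝔛 φ)
  mapL-isHom L M 𝔛 φ h = record
    { cong = λ e x → cong (e x)
    ; pres-∧ = λ a b x → pres-∧ (a x) (b x)
    ; pres-∨ = λ a b x → pres-∨ (a x) (b x)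
    ; pres-⊤ = λ x → pres-𝟙
    ; pres-⊥ = λ x → pres-𝟘
    ; pres-f = λ i as x →
        Eq.trans (pres-⋁ _) (⋁-cong _ _ (λ t → pres-⋀ⁿ (λ m → as m (proj₁ t m))))
    ; pres-g = λ j as x →
        Eq.trans (pres-⋀ _) (⋀-cong _ _ (λ t → pres-⋁ⁿ (λ m → as m (proj₁ t m))))
    }
    where
    open CompleteLattice M using (module Eq)
    open CompleteLatticeProperties M
    open IsLatStarHom h using (cong; pres-𝟘; pres-𝟙; pres-⋁; pres-⋀)
    open LatStarHomProperties h

  module _ (L : CompleteLattice ℓ) {X Y : Set ℓ} (p : X → Y) {n : ℕ}
           (T : (Fin n → X) → X → Set ℓ) (T′ : (Fin n → Y) → Y → Set ℓ)
           (pcond : PCond τ p T T′) (x : X)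
           (G : (Fin n → Y) → CompleteLattice.Carrier L)
           (G-cong : ∀ ys zs → (∀ m → ys m ≡ zs m) → CompleteLattice._≈_ L (G ys) (G zs)) where
    open CompleteLattice L using (_≈_; ⋁; ⋀; module Eq)
    open CompleteLatticeProperties L

    private
      image : Σ (Fin n → X) (λ xs → T xs x) → Σ (Fin n → Y) (λ ys → T′ ys (p x))
      image (xs , r) = p ∘ xs , Equivalence.from (pcond x (p ∘ xs)) (xs , r , λ _ → refl)

      image-covers : ∀ t → Σ _ λ s → G (proj₁ (image s)) ≈ G (proj₁ t)
      image-covers (ys , r′) with Equivalence.to (pcond x ys) r′
      ... | xs , r , pxs≡ys = (xs , r) , G-cong (p ∘ xs) ys pxs≡ys

    pcond-⋁ : ⋁ {Σ _ λ ys → T′ ys (p x)} (G ∘ proj₁)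
            ≈ ⋁ {Σ _ λ xs → T xs x} (λ t → G (p ∘ proj₁ t))
    pcond-⋁ = Eq.sym (⋁-cover image (G ∘ proj₁) image-covers)

    pcond-⋀ : ⋀ {Σ _ λ ys → T′ ys (p x)} (G ∘ proj₁)
            ≈ ⋀ {Σ _ λ xs → T xs x} (λ t → G (p ∘ proj₁ t))
    pcond-⋀ = Eq.sym (⋀-cover image (G ∘ proj₁) image-covers)

  mapX-isHom : (L : CompleteLattice ℓ) (𝔛 𝔜 : RelStr τ) (p : RelStr.X 𝔛 → RelStr.X 𝔜) →
    IsPMorphism τ 𝔛 𝔜 p → IsHom τ (Pow τ L 𝔜) (Pow τ L 𝔛) (mapX τ L 𝔛 𝔜 p)
  mapX-isHom L 𝔛 𝔜 p (pR , pS) = record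
    { cong = λ e x → e (p x)
    ; pres-∧ = λ a b x → Eq.refl
    ; pres-∨ = λ a b x → Eq.refl
    ; pres-⊤ = λ x → Eq.refl
    ; pres-⊥ = λ x → Eq.refl
    ; pres-f = λ i as x →
        pcond-⋁ L p (RelStr.R 𝔛 i) (RelStr.R 𝔜 i) (pR i) x
          (λ ys → ⋀ⁿ (λ m → as m (ys m)))
          (λ ys zs e → ⋀ⁿ-cong _ _ (λ m → Eq.reflexive (≡-cong (as m) (e m))))
    ; pres-g = λ j as x →
        pcond-⋀ L p (RelStr.S 𝔛 j) (RelStr.S 𝔜 j) (pS j) x
          (λ ys → ⋁ⁿ (λ m → as m (ys m)))
          (λ ys zs e → ⋁ⁿ-cong _ _ (λ m → Eq.reflexive (≡-cong (as m) (e m))))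
    }
    where
    open CompleteLattice L using (⋀ⁿ; ⋁ⁿ; module Eq)
    open CompleteLatticeProperties L

  tuple-isHom : (K : Set ℓ) (A : RawAlg τ) (B : K → RawAlg τ)
    (h : (k : K) → RawAlg.Carrier A → RawAlg.Carrier (B k)) →
    (∀ k → IsHom τ A (B k) (h k)) → IsHom τ A (∏Alg τ K B) (λ a k → h k a)
  tuple-isHom K A B h hom = record
    { cong = λ e k → IsHom.cong (hom k) e
    ; pres-∧ = λ a b k → IsHom.pres-∧ (hom k) a b
    ; pres-∨ = λ a b k → IsHom.pres-∨ (hom k) a b
    ; pres-⊤ = λ k → IsHom.pres-⊤ (hom k)
    ; pres-⊥ = λ k → IsHom.pres-⊥ (hom k)
    ; pres-f = λ i as k → IsHom.pres-f (hom k) i as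
    ; pres-g = λ j as k → IsHom.pres-g (hom k) j as
    }

  injection-isPMorphism : (K : Set ℓ) (𝔛s : K → RelStr τ) (k : K) →
    IsPMorphism τ (𝔛s k) (∐Rel τ K 𝔛s) (λ x → (k , x))
  injection-isPMorphism K 𝔛s k =
    (λ i → fibre (λ k′ → RelStr.R (𝔛s k′) i)) , (λ j → fibre (λ k′ → RelStr.S (𝔛s k′) j))
    where
    fibre : ∀ {n} (T : (k′ : K) → (Fin n → RelStr.X (𝔛s k′)) → RelStr.X (𝔛s k′) → Set ℓ) →
      PCond τ (λ x → (k , x)) (T k)
        (λ zs z → Σ (Fin n → RelStr.X (𝔛s (proj₁ z))) λ xs →
                    (∀ m → zs m ≡ (proj₁ z , xs m)) × T (proj₁ z) xs (proj₂ z))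
    fibre T x ys = mk⇔ (λ { (xs , e , r) → xs , r , (λ m → sym (e m)) })
                       (λ { (xs , r , e) → xs , (λ m → sym (e m)) , r })

  -- (∏ Lₖ)^{𝔛*} ≅ ∏ Lₖ^{𝔛*}: the comparison map tuples the maps induced by
  -- the projections, and as a map it is just uncurrying.
  productIso : (K : Set ℓ) (Ls : K → CompleteLattice ℓ) (𝔛 : RelStr τ) →
    IsHom τ (Pow τ (∏CL K Ls) 𝔛) (∏Alg τ K (λ k → Pow τ (Ls k) 𝔛)) (prodCmp τ K Ls 𝔛)
    × Injective (RawAlg._≈_ (Pow τ (∏CL K Ls) 𝔛))
                (RawAlg._≈_ (∏Alg τ K (λ k → Pow τ (Ls k) 𝔛))) (prodCmp τ K Ls 𝔛)
    × Surjective (RawAlg._≈_ (Pow τ (∏CL K Ls) 𝔛))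
                 (RawAlg._≈_ (∏Alg τ K (λ k → Pow τ (Ls k) 𝔛))) (prodCmp τ K Ls 𝔛)
  productIso K Ls 𝔛 =
    tuple-isHom K _ _ (λ k → mapL τ (∏CL K Ls) (Ls k) 𝔛 (λ a → a k))
      (λ k → mapL-isHom (∏CL K Ls) (Ls k) 𝔛 (λ a → a k) (projection-isLatStarHom K Ls k))
    , (λ e x k → e k x)
    , (λ β → (λ x k → β k x) , λ e k x → e x k)

  -- L^{(∐ 𝔛ₖ)*} ≅ ∏ L^{𝔛ₖ*}: the comparison map tuples the maps induced by
  -- the injections, and as a map it is just currying.
  coproductIso : (L : CompleteLattice ℓ) (K : Set ℓ) (𝔛s : K → RelStr τ) →
    IsHom τ (Pow τ L (∐Rel τ K 𝔛s)) (∏Alg τ K (λ k → Pow τ L (𝔛s k))) (coprodCmp τ L K 𝔛s)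
    × Injective (RawAlg._≈_ (Pow τ L (∐Rel τ K 𝔛s)))
                (RawAlg._≈_ (∏Alg τ K (λ k → Pow τ L (𝔛s k)))) (coprodCmp τ L K 𝔛s)
    × Surjective (RawAlg._≈_ (Pow τ L (∐Rel τ K 𝔛s)))
                 (RawAlg._≈_ (∏Alg τ K (λ k → Pow τ L (𝔛s k)))) (coprodCmp τ L K 𝔛s)
  coproductIso L K 𝔛s =
    tuple-isHom K _ _ (λ k → mapX τ L (𝔛s k) (∐Rel τ K 𝔛s) (λ x → (k , x)))
      (λ k → mapX-isHom L (𝔛s k) (∐Rel τ K 𝔛s) (λ x → (k , x)) (injection-isPMorphism K 𝔛s k))
    , (λ { e (k , x) → e k x })
    , (λ γ → (λ { (k , x) → γ k x }) , λ e k x → e (k , x))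

open CompleteLattice using (Carrier; _≈_)
open RelStr using (X)

theorem5p9 : {ℓ : Level} (τ : ExtType ℓ) →
  -- (0) L^{𝔛*} is an object of Alg_τ
  ((L : CompleteLattice ℓ) (𝔛 : RelStr τ) → IsAlg τ (Pow τ L 𝔛))
  -- (1) covariant action on Lat*-morphisms lands in Alg_τ-morphisms
  × ((L M : CompleteLattice ℓ) (𝔛 : RelStr τ) (φ : Carrier L → Carrier M) →
       IsLatStarHom L M φ → IsHom τ (Pow τ L 𝔛) (Pow τ M 𝔛) (mapL τ L M 𝔛 φ))
  -- (2) contravariant action on p-morphisms lands in Alg_τ-morphisms
  × ((L : CompleteLattice ℓ) (𝔛 𝔜 : RelStr τ) (p : X 𝔛 → X 𝔜) →
       IsPMorphism τ 𝔛 𝔜 p → IsHom τ (Pow τ L 𝔜) (Pow τ L 𝔛) (mapX τ L 𝔛 𝔜 p))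
  -- (3) functor laws in the first argument
  × ((L : CompleteLattice ℓ) (𝔛 : RelStr τ) (α : RawAlg.Carrier (Pow τ L 𝔛)) →
       RawAlg._≈_ (Pow τ L 𝔛) (mapL τ L L 𝔛 id α) α)
  × ((L M N : CompleteLattice ℓ) (𝔛 : RelStr τ)
     (φ : Carrier L → Carrier M) (ψ : Carrier M → Carrier N) →
       IsLatStarHom L M φ → IsLatStarHom M N ψ →
       (α : RawAlg.Carrier (Pow τ L 𝔛)) →
       RawAlg._≈_ (Pow τ N 𝔛) (mapL τ L N 𝔛 (ψ ∘ φ) α)
                              (mapL τ M N 𝔛 ψ (mapL τ L M 𝔛 φ α)))
  -- (4) functor laws in the second argument (contravariant)
  × ((L : CompleteLattice ℓ) (𝔛 : RelStr τ) (β : RawAlg.Carrier (Pow τ L 𝔛)) →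
       RawAlg._≈_ (Pow τ L 𝔛) (mapX τ L 𝔛 𝔛 id β) β)
  × ((L : CompleteLattice ℓ) (𝔛 𝔜 ℨ : RelStr τ) (p : X 𝔛 → X 𝔜) (q : X 𝔜 → X ℨ) →
       IsPMorphism τ 𝔛 𝔜 p → IsPMorphism τ 𝔜 ℨ q →
       (γ : RawAlg.Carrier (Pow τ L ℨ)) →
       RawAlg._≈_ (Pow τ L 𝔛) (mapX τ L 𝔛 ℨ (q ∘ p) γ)
                              (mapX τ L 𝔛 𝔜 p (mapX τ L 𝔜 ℨ q γ)))
  -- (5) the two actions commute (bifunctoriality)
  × ((L M : CompleteLattice ℓ) (𝔛 𝔜 : RelStr τ)
     (φ : Carrier L → Carrier M) (p : X 𝔛 → X 𝔜) →
       IsLatStarHom L M φ → IsPMorphism τ 𝔛 𝔜 p →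
       (β : RawAlg.Carrier (Pow τ L 𝔜)) →
       RawAlg._≈_ (Pow τ M 𝔛) (mapL τ L M 𝔛 φ (mapX τ L 𝔛 𝔜 p β))
                              (mapX τ M 𝔛 𝔜 p (mapL τ L M 𝔜 φ β)))
  -- (6) (∏ L_k)^{𝔛*} ≅ ∏ L_k^{𝔛*} via the canonical map
  × ((K : Set ℓ) (Ls : K → CompleteLattice ℓ) (𝔛 : RelStr τ) →
       IsHom τ (Pow τ (∏CL K Ls) 𝔛) (∏Alg τ K (λ k → Pow τ (Ls k) 𝔛)) (prodCmp τ K Ls 𝔛)
       × Injective (RawAlg._≈_ (Pow τ (∏CL K Ls) 𝔛))
                   (RawAlg._≈_ (∏Alg τ K (λ k → Pow τ (Ls k) 𝔛))) (prodCmp τ K Ls 𝔛)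
       × Surjective (RawAlg._≈_ (Pow τ (∏CL K Ls) 𝔛))
                    (RawAlg._≈_ (∏Alg τ K (λ k → Pow τ (Ls k) 𝔛))) (prodCmp τ K Ls 𝔛))
  -- (7) L^{(∐ 𝔛_k)*} ≅ ∏ L^{𝔛_k*} via the canonical map
  × ((L : CompleteLattice ℓ) (K : Set ℓ) (𝔛s : K → RelStr τ) →
       IsHom τ (Pow τ L (∐Rel τ K 𝔛s)) (∏Alg τ K (λ k → Pow τ L (𝔛s k))) (coprodCmp τ L K 𝔛s)
       × Injective (RawAlg._≈_ (Pow τ L (∐Rel τ K 𝔛s)))
                   (RawAlg._≈_ (∏Alg τ K (λ k → Pow τ L (𝔛s k)))) (coprodCmp τ L K 𝔛s)
       × Surjective (RawAlg._≈_ (Pow τ L (∐Rel τ K 𝔛s)))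
                    (RawAlg._≈_ (∏Alg τ K (λ k → Pow τ L (𝔛s k)))) (coprodCmp τ L K 𝔛s))
  -- (8) φ one-one (onto) ⇒ α ↦ φ ∘ α one-one (onto); converse if X nonempty
  × ((L M : CompleteLattice ℓ) (𝔛 : RelStr τ) (φ : Carrier L → Carrier M) →
       IsLatStarHom L M φ →
       (Injective (_≈_ L) (_≈_ M) φ →
          Injective (RawAlg._≈_ (Pow τ L 𝔛)) (RawAlg._≈_ (Pow τ M 𝔛)) (mapL τ L M 𝔛 φ))
       × (Surjective (_≈_ L) (_≈_ M) φ →
          Surjective (RawAlg._≈_ (Pow τ L 𝔛)) (RawAlg._≈_ (Pow τ M 𝔛)) (mapL τ L M 𝔛 φ))
       × (X 𝔛 → Injective (RawAlg._≈_ (Pow τ L 𝔛)) (RawAlg._≈_ (Pow τ M 𝔛)) (mapL τ L M 𝔛 φ) →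
          Injective (_≈_ L) (_≈_ M) φ)
       × (X 𝔛 → Surjective (RawAlg._≈_ (Pow τ L 𝔛)) (RawAlg._≈_ (Pow τ M 𝔛)) (mapL τ L M 𝔛 φ) →
          Surjective (_≈_ L) (_≈_ M) φ))
  -- (9) p one-one ⇒ β ↦ β ∘ p onto;  p onto ⇒ β ↦ β ∘ p one-one
  × ((L : CompleteLattice ℓ) (𝔛 𝔜 : RelStr τ) (p : X 𝔛 → X 𝔜) →
       IsPMorphism τ 𝔛 𝔜 p →
       (Injective _≡_ _≡_ p →
          Surjective (RawAlg._≈_ (Pow τ L 𝔜)) (RawAlg._≈_ (Pow τ L 𝔛)) (mapX τ L 𝔛 𝔜 p))
       × (Surjective _≡_ _≡_ p →
          Injective (RawAlg._≈_ (Pow τ L 𝔜)) (RawAlg._≈_ (Pow τ L 𝔛)) (mapX τ L 𝔛 𝔜 p)))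
theorem5p9 τ =
  Pow-isAlg τ
  , mapL-isHom τ
  , mapX-isHom τ
  , (λ L 𝔛 α x → Eq.refl L)
  , (λ L M N 𝔛 φ ψ _ _ α x → Eq.refl N)
  , (λ L 𝔛 β x → Eq.refl L)
  , (λ L 𝔛 𝔜 ℨ p q _ _ γ x → Eq.refl L)
  , (λ L M 𝔛 𝔜 φ p _ _ β x → Eq.refl M)
  , productIso τ
  , coproductIso τ
  , (λ L M 𝔛 φ h →
       Postcomposition.injective (_≈_ L) (_≈_ M) φ (X 𝔛)
     , Postcomposition.surjective (_≈_ L) (_≈_ M) φ (X 𝔛)
     , Postcomposition.injective⁻¹ (_≈_ L) (_≈_ M) φ (X 𝔛)
     , Postcomposition.surjective⁻¹ (_≈_ L) (_≈_ M) φ (X 𝔛)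
         (IsLatStarHom.cong h) (Eq.refl L) (Eq.trans M))
  , (λ L 𝔛 𝔜 p _ →
       CompleteLatticeProperties.precompose-surjective L p
     , precompose-injective {_≈_ = _≈_ L} p)
  where open CompleteLattice using (module Eq)
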